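{- Let $\mathbf{P}$ be a partially ordered set, let $\mathbf{K}$ be a join-completion of $\mathbf{P}$, and let $L$ be a subset of $K$ with $P\subseteq L$. Then $L$, with the partial order induced from $\mathbf{K}$, is a join-completion of $\mathbf{P}$ if and only if $L$ is a closure system of $\mathbf{K}$.
   Context: A partially ordered set $\mathbf{L}$ is a join-extension of a partially ordered set $\mathbf{P}$ if $P\subseteq L$, the order of $\mathbf{L}$ restricts to that of $\mathbf{P}$, and every element of $L$ is the join in $\mathbf{L}$ of a subset of $P$; it is a join-completion if in addition $\mathbf{L}$ is a complete lattice. A closure system of a poset $\mathbf{K}$ is a subset $C\subseteq K$ such that for every $x\in K$ the element $\min\{c\in C\mid x\le c\}$ exists. -}

module Defs where

open import Level using (Level; _⊔_)
open import Data.Product using (Σ; _×_)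
open import Relation.Unary using (Pred; _∈_; _⊆_; U)
open import Relation.Binary.Bundles using (Poset)

-- All subsets (P, L, and the subsets whose joins are taken) are predicates on
-- the carrier of K; orders on them are the ones induced from K.
module _ {c ℓ₁ ℓ₂ : Level} (K : Poset c ℓ₁ ℓ₂) where
  open Poset K renaming (Carrier to A)

  IsUpperBound : ∀ {ℓ} → Pred A ℓ → A → Set (c ⊔ ℓ ⊔ ℓ₂)
  IsUpperBound S x = ∀ {s} → s ∈ S → s ≤ x

  IsJoinIn : ∀ {ℓ ℓ'} → Pred A ℓ' → Pred A ℓ → A → Set (c ⊔ ℓ ⊔ ℓ' ⊔ ℓ₂)
  IsJoinIn X S x =
    x ∈ X × IsUpperBound S x × (∀ {y} → y ∈ X → IsUpperBound S y → x ≤ y)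

  IsJoinExtension : (ℓ : Level) → ∀ {ℓp ℓl} → Pred A ℓp → Pred A ℓl → Set _
  IsJoinExtension ℓ P L =
    P ⊆ L × (∀ {x} → x ∈ L → Σ (Pred A ℓ) λ S → S ⊆ P × IsJoinIn L S x)

  IsCompleteIn : (ℓ : Level) → ∀ {ℓl} → Pred A ℓl → Set _
  IsCompleteIn ℓ L = (S : Pred A ℓ) → S ⊆ L → Σ A (IsJoinIn L S)

  IsJoinCompletion : (ℓ : Level) → ∀ {ℓp ℓl} → Pred A ℓp → Pred A ℓl → Set _
  IsJoinCompletion ℓ P L = IsJoinExtension ℓ P L × IsCompleteIn ℓ L

  IsClosureSystem : ∀ {ℓl} → Pred A ℓl → Set _
  IsClosureSystem L =
    ∀ x → Σ A λ m → (m ∈ L × x ≤ m) × (∀ {y} → y ∈ L → x ≤ y → m ≤ y)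

-- Every x in K is the join in K of some S ⊆ P. If L is complete, the join of
-- that S in L is the least element of L above x. Conversely, if L is a closure
-- system, the closure of the join in K of any S ⊆ L is its join in L, and
-- joins in K of subsets of P that happen to lie in L are joins in L as well.
module Submission where

open import Defs
open import Level using (Level)
open import Relation.Unary using (Pred; _∈_; _⊆_; U)
open import Relation.Binary.Bundles using (Poset)
open import Function.Bundles using (_⇔_; mk⇔)
open import Data.Product using (_×_; _,_; map₂)
open import Data.Unit using (tt)

module _ {c ℓ₁ ℓ₂ : Level} (K : Poset c ℓ₁ ℓ₂) where
  open Poset K renaming (Carrier to A)

  IsLeastAbove : ∀ {ℓ} → Pred A ℓ → A → A → Set _
  IsLeastAbove L x m = (m ∈ L × x ≤ m) × (∀ {y} → y ∈ L → x ≤ y → m ≤ y)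

  module _ {ℓs ℓx ℓy : Level} {S : Pred A ℓs} {X : Pred A ℓx} {Y : Pred A ℓy} where

    isJoinIn-⊆ : ∀ {x} → Y ⊆ X → x ∈ Y → IsJoinIn K X S x → IsJoinIn K Y S x
    isJoinIn-⊆ Y⊆X x∈Y (_ , x-ub , x-least) =
      x∈Y , x-ub , λ y∈Y → x-least (Y⊆X y∈Y)

    isJoinIn⇒isLeastAbove : ∀ {x m} → m ∈ X →
                            IsJoinIn K X S x → IsJoinIn K Y S m → IsLeastAbove Y x m
    isJoinIn⇒isLeastAbove m∈X (_ , x-ub , x-least) (m∈Y , m-ub , m-least) =
      (m∈Y , x-least m∈X m-ub) ,
      λ y∈Y x≤y → m-least y∈Y (λ s∈S → trans (x-ub s∈S) x≤y)

    isLeastAbove⇒isJoinIn : ∀ {j m} → Y ⊆ X →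
                            IsJoinIn K X S j → IsLeastAbove Y j m → IsJoinIn K Y S m
    isLeastAbove⇒isJoinIn Y⊆X (_ , j-ub , j-least) ((m∈Y , j≤m) , m-least) =
      m∈Y , (λ s∈S → trans (j-ub s∈S) j≤m) ,
      λ y∈Y y-ub → m-least y∈Y (j-least (Y⊆X y∈Y) y-ub)

  module _ {ℓ ℓp ℓl : Level} {P : Pred A ℓp} {L : Pred A ℓl} where

    isJoinExtension-⊆ : IsJoinExtension K ℓ P U → P ⊆ L → IsJoinExtension K ℓ P L
    isJoinExtension-⊆ (_ , extK) P⊆L =
      P⊆L , λ x∈L → map₂ (map₂ (isJoinIn-⊆ (λ _ → tt) x∈L)) (extK tt)

    isCompleteIn⇒isClosureSystem : IsJoinExtension K ℓ P U → P ⊆ L →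
                                   IsCompleteIn K ℓ L → IsClosureSystem K L
    isCompleteIn⇒isClosureSystem (_ , extK) P⊆L compL x =
      let S , S⊆P , x-join = extK tt
          m , m-join       = compL S (λ s∈S → P⊆L (S⊆P s∈S))
      in m , isJoinIn⇒isLeastAbove tt x-join m-join

  isClosureSystem⇒isCompleteIn : ∀ {ℓ ℓl} {L : Pred A ℓl} →
                                 IsCompleteIn K ℓ U → IsClosureSystem K L → IsCompleteIn K ℓ L
  isClosureSystem⇒isCompleteIn compK closure S S⊆L =
    let j , j-join = compK S (λ _ → tt)
        m , m-least = closure j
    in m , isLeastAbove⇒isJoinIn (λ _ → tt) j-join m-least

proposition3p2 : ∀ {c ℓ₁ ℓ₂ ℓ : Level} (K : Poset c ℓ₁ ℓ₂)
                   (P L : Pred (Poset.Carrier K) ℓ) →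
                   IsJoinCompletion K ℓ P U → P ⊆ L →
                   (IsJoinCompletion K ℓ P L ⇔ IsClosureSystem K L)
proposition3p2 K P L (extK , compK) P⊆L = mk⇔
  (λ (_ , compL) → isCompleteIn⇒isClosureSystem K extK P⊆L compL)
  (λ closure → isJoinExtension-⊆ K extK P⊆L , isClosureSystem⇒isCompleteIn K compK closure)
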